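{- Let $t,L$ be positive integers, let $H$ be a graph on $L$ vertices, and let $G$ be an ordered graph containing the blow-up $H(t2^L)$ as a subgraph. Then there exist an ordering $u_1,\dots,u_L$ of $V(H)$ and a copy of the blow-up $H(t)$ in $G$, with parts $W_{u_1},\dots,W_{u_L}$ (each of size $t$), such that whenever $i<j$, every vertex of $W_{u_i}$ precedes every vertex of $W_{u_j}$ in the order of $G$.
   Context: An ordered graph is a graph together with a total order of its vertex set. For a graph $F$ and a positive integer $s$, the blow-up $F(s)$ is obtained by replacing each vertex $v$ of $F$ by an independent set $W_v$ of $s$ vertices (the part of $v$) and, for every edge $uv$ of $F$, adding all edges between $W_u$ and $W_v$. -}

module Defs where

open import Level using (0ℓ)
open import Data.Nat using (ℕ)
open import Data.Fin using (Fin; _<_)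
open import Data.Fin.Permutation using (Permutation′; _⟨$⟩ʳ_)
open import Data.Product using (_×_; _,_)
open import Relation.Binary.PropositionalEquality using (_≡_)
open import Relation.Nullary using (¬_)

record Graph (n : ℕ) : Set₁ where
  field
    Adj   : Fin n → Fin n → Set
    sym   : ∀ {x y} → Adj x y → Adj y x
    irrefl : ∀ {x} → ¬ Adj x x
open Graph public

-- An ordered graph on n vertices: a graph on Fin n, ordered by the
-- natural order of Fin n (every finite totally ordered vertex set is
-- order-isomorphic to Fin n with its usual order).
OrderedGraph : ℕ → Set₁
OrderedGraph = Graph

-- A copy of the blow-up F(s) as a (not necessarily induced) subgraph of G:
-- vertex (v , a) of F(s) (v ∈ V(F), a ∈ Fin s) is mapped to embed (v , a);
-- the part W_v is { embed (v , a) | a : Fin s }.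
record BlowUpCopy {l n : ℕ} (F : Graph l) (s : ℕ) (G : Graph n) : Set where
  field
    embed     : Fin l × Fin s → Fin n
    injective : ∀ p q → embed p ≡ embed q → p ≡ q
    edges     : ∀ u v → Adj F u v → ∀ a b → Adj G (embed (u , a)) (embed (v , b))
open BlowUpCopy public

PartsOrderedBy : {l n s : ℕ} {F : Graph l} {G : Graph n} →
                 BlowUpCopy F s G → Permutation′ l → Set
PartsOrderedBy {l} {n} {s} c σ =
  ∀ (i j : Fin l) → i < j → ∀ (a b : Fin s) →
    embed c (σ ⟨$⟩ʳ i , a) < embed c (σ ⟨$⟩ʳ j , b)

-- Parts of size N ≥ t·L already suffice. Take the least threshold x at which
-- some part W has t vertices below x. Raising the threshold by one adds at most
-- one vertex of each part, so no part has more than t vertices below x, and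
-- every other part keeps at least N − t vertices at or above x. Put t vertices
-- of W below x first and recurse on the other L − 1 parts, each restricted to
-- N − t of its vertices above x.
module Submission where

open import Defs
open import Data.Nat using (ℕ; _*_; _^_; _≤_)
open import Data.Fin.Permutation using (Permutation′)
open import Data.Product using (Σ)

open import Level using (Level)
open import Data.Nat using (zero; suc; _+_; _∸_; _<_; _<?_; _≤?_; z≤n; s≤s)
open import Data.Nat.Properties
  using ( ≤-reflexive; ≤-trans; <-≤-trans; ≰⇒>; n≤1+n; m≤n⇒m≤1+n; m≤m+n
        ; +-suc; +-comm; +-mono-≤; +-monoʳ-≤; *-suc; *-monoʳ-≤; m^n>0; ∸-monoʳ-≤
        ; m+n≤o⇒m≤o; m+n≤o⇒m≤o∸n; m≤n+o⇒m∸n≤o; <-≤-connex; m<1+n⇒m<n∨m≡n )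
import Data.Nat.Properties as ℕ
open import Data.Fin as Fin using (Fin; zero; suc; toℕ; punchIn; lift)
open import Data.Fin.Properties using (any?; toℕ<n; toℕ-injective; suc-injective; lift-injective; 0≢1+n)
open import Data.Fin.Permutation using (_⟨$⟩ʳ_; _⟨$⟩ˡ_; id; insert; insert-punchIn; inverseˡ)
open import Data.Product using (_×_; _,_; proj₂; ∃-syntax)
open import Data.Product.Properties using (,-injective)
open import Data.Sum using (_⊎_; [_,_])
open import Data.Unit using (tt)
open import Function using (_∘_)
open import Function.Definitions using (Injective)
open import Relation.Binary.Definitions using (DecidableEquality)
open import Relation.Binary.PropositionalEquality
  using (_≡_; refl; cong; subst; subst₂; trans) renaming (sym to ≡-sym)
open import Relation.Nullary using (¬_; yes; no; contradiction)
open import Relation.Unary using (Pred; Decidable)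

private
  variable
    a p q r : Level
    A : Set a
    k l m n s t N : ℕ

count : {P : Pred (Fin N) p} → Decidable P → ℕ
count {N = zero}  P? = 0
count {N = suc N} P? with P? zero
... | yes _ = suc (count (P? ∘ suc))
... | no  _ = count (P? ∘ suc)

count-none : {P : Pred (Fin N) p} (P? : Decidable P) → (∀ i → ¬ P i) → count P? ≡ 0
count-none {N = zero}  _  _    = refl
count-none {N = suc N} P? none with P? zero
... | yes pz = contradiction pz (none zero)
... | no  _  = count-none (P? ∘ suc) (none ∘ suc)

count-all : {P : Pred (Fin N) p} (P? : Decidable P) → (∀ i → P i) → count P? ≡ N
count-all {N = zero}  _  _   = refl
count-all {N = suc N} P? all with P? zero
... | yes _   = cong suc (count-all (P? ∘ suc) (all ∘ suc))
... | no  ¬pz = contradiction (all zero) ¬pz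

count-⊎ : {P : Pred (Fin N) p} {Q : Pred (Fin N) q} {R : Pred (Fin N) r}
          (P? : Decidable P) (Q? : Decidable Q) (R? : Decidable R) →
          (∀ i → P i → Q i ⊎ R i) → count P? ≤ count Q? + count R?
count-⊎ {N = zero}  _  _  _  _ = z≤n
count-⊎ {N = suc N} P? Q? R? split
  with P? zero | Q? zero | R? zero | count-⊎ (P? ∘ suc) (Q? ∘ suc) (R? ∘ suc) (split ∘ suc)
... | yes _  | yes _  | yes _  | ih = s≤s (≤-trans ih (+-monoʳ-≤ _ (n≤1+n _)))
... | yes _  | yes _  | no  _  | ih = s≤s ih
... | yes _  | no  _  | yes _  | ih = ≤-trans (s≤s ih) (≤-reflexive (≡-sym (+-suc _ _)))
... | yes pz | no ¬qz | no ¬rz | _  = contradiction (split zero pz) [ ¬qz , ¬rz ]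
... | no  _  | yes _  | yes _  | ih = m≤n⇒m≤1+n (≤-trans ih (+-monoʳ-≤ _ (n≤1+n _)))
... | no  _  | yes _  | no  _  | ih = m≤n⇒m≤1+n ih
... | no  _  | no  _  | yes _  | ih = ≤-trans ih (+-monoʳ-≤ _ (n≤1+n _))
... | no  _  | no  _  | no  _  | ih = ih

count-cover : {Q : Pred (Fin N) q} {R : Pred (Fin N) r} (Q? : Decidable Q) (R? : Decidable R) →
              (∀ i → Q i ⊎ R i) → N ≤ count Q? + count R?
count-cover Q? R? cover =
  subst (_≤ count Q? + count R?) (count-all (λ _ → yes tt) (λ _ → tt)) (count-⊎ (λ _ → yes tt) Q? R? (λ i _ → cover i))

count-fiber≤1 : (_≟_ : DecidableEquality A) (f : Fin N → A) → Injective _≡_ _≡_ f →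
                ∀ y → count (λ i → f i ≟ y) ≤ 1
count-fiber≤1 {N = zero}  _≟_ f f-inj y = z≤n
count-fiber≤1 {N = suc N} _≟_ f f-inj y with f zero ≟ y
... | yes f0≡y = s≤s (≤-reflexive (count-none (λ i → f (suc i) ≟ y) λ i fi≡y → 0≢1+n (f-inj (trans f0≡y (≡-sym fi≡y)))))
... | no  _    = count-fiber≤1 _≟_ (f ∘ suc) (suc-injective ∘ f-inj) y

record Selection (k : ℕ) (P : Pred (Fin N) p) : Set p where
  field
    choose           : Fin k → Fin N
    choose-injective : Injective _≡_ _≡_ choose
    choose-sound     : ∀ a → P (choose a)
open Selection

≤count⇒selection : {P : Pred (Fin N) p} (P? : Decidable P) → k ≤ count P? → Selection k P
≤count⇒selection {N = zero} {k = zero} P? _ =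
  record { choose = λ () ; choose-injective = λ {} ; choose-sound = λ () }
≤count⇒selection {N = suc N} {k = k} {P = P} P? k≤ with P? zero
... | yes pz = extend k k≤
  where
  extend : ∀ k → k ≤ suc (count (P? ∘ suc)) → Selection k P
  extend zero    _        = record { choose = λ () ; choose-injective = λ {} ; choose-sound = λ () }
  extend (suc k) (s≤s k≤) = record
    { choose           = lift 1 (choose rest)
    ; choose-injective = lift-injective (choose rest) (choose-injective rest) 1
    ; choose-sound     = λ { zero → pz ; (suc a) → choose-sound rest a }
    }
    where
    rest : Selection k (P ∘ suc)
    rest = ≤count⇒selection (P? ∘ suc) k≤
... | no _ = record
  { choose           = suc ∘ choose rest
  ; choose-injective = choose-injective rest ∘ suc-injective
  ; choose-sound     = choose-sound rest
  }
  where
  rest : Selection k (P ∘ suc)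
  rest = ≤count⇒selection (P? ∘ suc) k≤

level-crossing : {k : ℕ} (t : ℕ) (g : Fin k → ℕ → ℕ) →
                 (∀ v y → g v (suc y) ≤ suc (g v y)) → (∀ v → g v 0 ≤ t) →
                 ∀ y v → t ≤ g v y → ∃[ z ] (∃[ u ] t ≤ g u z) × (∀ w → g w z ≤ t)
level-crossing t g slow start zero    v t≤gv = 0 , (v , t≤gv) , start
level-crossing t g slow start (suc y) v t≤gv with any? (λ u → t ≤? g u y)
... | yes (u , t≤gu) = level-crossing t g slow start y u t≤gu
... | no  none       = suc y , (v , t≤gv) , λ w → ≤-trans (slow w y) (≰⇒> (λ t≤gw → none (w , t≤gw)))

below? : (f : Fin N → Fin n) (x : ℕ) → Decidable (λ a → toℕ (f a) < x)
below? f x a = toℕ (f a) <? x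

below : (Fin N → Fin n) → ℕ → ℕ
below f x = count (below? f x)

module _ (f : Fin N → Fin n) where

  below-zero : below f 0 ≡ 0
  below-zero = count-none (below? f 0) (λ a ())

  below-all : below f n ≡ N
  below-all = count-all (below? f n) (λ a → toℕ<n (f a))

  below-suc : Injective _≡_ _≡_ f → ∀ x → below f (suc x) ≤ suc (below f x)
  below-suc f-inj x = begin
    below f (suc x)                            ≤⟨ count-⊎ (below? f (suc x)) (below? f x) at-x? (λ a → m<1+n⇒m<n∨m≡n) ⟩
    below f x + count at-x?                    ≤⟨ +-monoʳ-≤ (below f x) (count-fiber≤1 ℕ._≟_ (toℕ ∘ f) (f-inj ∘ toℕ-injective) x) ⟩
    below f x + 1                              ≡⟨ +-comm (below f x) 1 ⟩
    suc (below f x)                            ∎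
    where
    open ℕ.≤-Reasoning
    at-x? : Decidable (λ a → toℕ (f a) ≡ x)
    at-x? a = toℕ (f a) ℕ.≟ x

  selection-below : ∀ {x} → t ≤ below f x → Selection t (λ a → toℕ (f a) < x)
  selection-below {x = x} = ≤count⇒selection (below? f x)

  selection-above : ∀ {x} → below f x ≤ t → Selection (N ∸ t) (λ a → x ≤ toℕ (f a))
  selection-above {t = t} {x = x} below≤t = ≤count⇒selection above? (begin
    N ∸ t            ≤⟨ ∸-monoʳ-≤ N below≤t ⟩
    N ∸ below f x    ≤⟨ m≤n+o⇒m∸n≤o N (below f x) (count-cover (below? f x) above? (λ a → <-≤-connex (toℕ (f a)) x)) ⟩
    count above?     ∎)
    where
    open ℕ.≤-Reasoning
    above? : Decidable (λ a → x ≤ toℕ (f a))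
    above? a = x ≤? toℕ (f a)

record Layering (t : ℕ) {L : ℕ} (f : Fin L → Fin N → Fin n) : Set where
  field
    order          : Permutation′ L
    pick           : Fin L → Fin t → Fin N
    pick-injective : ∀ i → Injective _≡_ _≡_ (pick i)
    increasing     : ∀ {i j} → i Fin.< j → ∀ a b →
                     f (order ⟨$⟩ʳ i) (pick i a) Fin.< f (order ⟨$⟩ʳ j) (pick j b)

layering-insert : {L : ℕ} (f : Fin (suc L) → Fin N → Fin n) (v₀ : Fin (suc L)) (x : ℕ) →
                  Selection t (λ a → toℕ (f v₀ a) < x) →
                  (high : ∀ v → Selection m (λ b → x ≤ toℕ (f v b))) →
                  Layering t (λ w → f (punchIn v₀ w) ∘ choose (high (punchIn v₀ w))) →
                  Layering t f
layering-insert {N = N} {t = t} {L = L} f v₀ x low high rest = record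
  { order          = σ
  ; pick           = pick′
  ; pick-injective = pick′-injective
  ; increasing     = increasing′
  }
  where
  module R = Layering rest

  σ : Permutation′ (suc L)
  σ = insert zero v₀ R.order

  pick′ : Fin (suc L) → Fin t → Fin N
  pick′ zero    = choose low
  pick′ (suc i) = choose (high (σ ⟨$⟩ʳ suc i)) ∘ R.pick i

  pick′-injective : ∀ i → Injective _≡_ _≡_ (pick′ i)
  pick′-injective zero    = choose-injective low
  pick′-injective (suc i) = R.pick-injective i ∘ choose-injective (high _)

  layer-suc : ∀ i b → f (σ ⟨$⟩ʳ suc i) (pick′ (suc i) b) ≡
              f (punchIn v₀ (R.order ⟨$⟩ʳ i)) (choose (high (punchIn v₀ (R.order ⟨$⟩ʳ i))) (R.pick i b))
  layer-suc i b = cong (λ v → f v (choose (high v) (R.pick i b))) (insert-punchIn zero v₀ R.order i)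

  increasing′ : ∀ {i j} → i Fin.< j → ∀ a b →
                f (σ ⟨$⟩ʳ i) (pick′ i a) Fin.< f (σ ⟨$⟩ʳ j) (pick′ j b)
  increasing′ {zero}  {suc j} _         a b = <-≤-trans (choose-sound low a) (choose-sound (high _) (R.pick j b))
  increasing′ {suc i} {suc j} (s≤s i<j) a b =
    subst₂ Fin._<_ (≡-sym (layer-suc i a)) (≡-sym (layer-suc j b)) (R.increasing i<j a b)

layering : ∀ t L (f : Fin L → Fin N → Fin n) → (∀ v → Injective _≡_ _≡_ (f v)) → t * L ≤ N → Layering t f
layering t zero f _ _ = record
  { order = id ; pick = λ () ; pick-injective = λ () ; increasing = λ { {()} } }
layering {N = N} {n = n} t (suc L) f f-inj tL≤N
  with level-crossing t (below ∘ f) (λ v → below-suc (f v) (f-inj v))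
         (λ v → subst (_≤ t) (≡-sym (below-zero (f v))) z≤n) n zero
         (subst (t ≤_) (≡-sym (below-all (f zero))) (m+n≤o⇒m≤o t t+tL≤N))
  where
  t+tL≤N : t + t * L ≤ N
  t+tL≤N = subst (_≤ N) (*-suc t L) tL≤N
... | x , (v₀ , t≤below) , below≤t =
  layering-insert f v₀ x (selection-below (f v₀) t≤below) high (layering t L rest rest-injective tL≤N∸t)
  where
  high : ∀ v → Selection (N ∸ t) (λ b → x ≤ toℕ (f v b))
  high v = selection-above (f v) (below≤t v)

  rest : Fin L → Fin (N ∸ t) → Fin n
  rest w = f (punchIn v₀ w) ∘ choose (high (punchIn v₀ w))

  rest-injective : ∀ w → Injective _≡_ _≡_ (rest w)
  rest-injective w = choose-injective (high _) ∘ f-inj _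

  tL≤N∸t : t * L ≤ N ∸ t
  tL≤N∸t = m+n≤o⇒m≤o∸n (t * L) (subst (_≤ N) (trans (*-suc t L) (+-comm t (t * L))) tL≤N)

n≤2^n : ∀ n → n ≤ 2 ^ n
n≤2^n zero    = z≤n
n≤2^n (suc n) = +-mono-≤ (m^n>0 2 n) (≤-trans (n≤2^n n) (m≤m+n (2 ^ n) 0))

parts : {F : Graph l} {G : Graph n} → BlowUpCopy F s G → Fin l → Fin s → Fin n
parts c v a = embed c (v , a)

parts-injective : {F : Graph l} {G : Graph n} (c : BlowUpCopy F s G) → ∀ v → Injective _≡_ _≡_ (parts c v)
parts-injective c v = proj₂ ∘ ,-injective ∘ injective c _ _

layered-subcopy : {F : Graph l} {G : Graph n} (c : BlowUpCopy F s G) (ℒ : Layering t (parts c)) →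
                  Σ (BlowUpCopy F t G) (λ c′ → PartsOrderedBy c′ (Layering.order ℒ))
layered-subcopy {l = l} {n = n} {t = t} {F = F} {G = G} c ℒ = c′ , ordered
  where
  open Layering ℒ

  embed′ : Fin l × Fin t → Fin n
  embed′ (v , a) = embed c (v , pick (order ⟨$⟩ˡ v) a)

  embed′-injective : ∀ p q → embed′ p ≡ embed′ q → p ≡ q
  embed′-injective (v , a) (w , b) e with ,-injective (injective c _ _ e)
  ... | refl , picks≡ = cong (v ,_) (pick-injective (order ⟨$⟩ˡ v) picks≡)

  c′ : BlowUpCopy F t G
  c′ = record
    { embed     = embed′
    ; injective = embed′-injective
    ; edges     = λ u v uv a b → edges c u v uv _ _
    }

  ordered : PartsOrderedBy c′ order
  ordered i j i<j a b rewrite inverseˡ order {i} | inverseˡ order {j} = increasing i<j a b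

-- Both positivity hypotheses are unnecessary: for t = 0 or L = 0 the copy is empty.
lemma2p5 : (t L : ℕ) → 1 ≤ t → 1 ≤ L → (H : Graph L) →
    (n : ℕ) → (G : OrderedGraph n) → BlowUpCopy H (t * 2 ^ L) G →
    Σ (Permutation′ L) (λ σ → Σ (BlowUpCopy H t G) (λ c → PartsOrderedBy c σ))
lemma2p5 t L _ _ H n G c = Layering.order ℒ , layered-subcopy c ℒ
  where
  ℒ : Layering t (parts c)
  ℒ = layering t L (parts c) (parts-injective c) (*-monoʳ-≤ t (n≤2^n L))
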